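{- Let $M=M(S_0,\dots,S_r)$ be the freedom matroid of a flag on $S$, and let $A$ be an independent set of $M$. Then the closure of $A$ in $M$ is $\mathrm{cl}(A)=A\cup S_m$, where $m=\max\{i : |A\cap S_i|=i\}$.
   Context: A flag on a finite set $S$ is a sequence $(S_0,\dots,S_r)$ with $S_r=S$ and $S_{i-1}\subsetneq S_i$ for $1\le i\le r$. The freedom matroid $M(S_0,\dots,S_r)$ is the matroid on $S$ whose independent sets are the $I\subseteq S$ with $|I\cap S_i|\le i$ for all $i$. -}

module Defs where

open import Data.Nat using (ℕ; suc; _≤_)
open import Data.Fin using (Fin; toℕ; fromℕ; inject₁)
open import Data.Fin.Subset using (Subset; ⊤; ⁅_⁆; _∈_; _⊆_; _⊂_; _∩_; _∪_; ∣_∣)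
open import Data.Product using (Σ; _×_; ∃)
open import Relation.Binary.PropositionalEquality using (_≡_)

record Flag (n : ℕ) : Set where
  field
    r       : ℕ
    set     : Fin (suc r) → Subset n
    top     : set (fromℕ r) ≡ ⊤
    strict  : (i : Fin r) → set (inject₁ i) ⊂ set (Data.Fin.suc i)

open Flag public

Independent : ∀ {n} → Flag n → Subset n → Set
Independent F I = (i : Fin (suc (r F))) → ∣ I ∩ set F i ∣ ≤ toℕ i

IsRank : ∀ {n} → Flag n → Subset n → ℕ → Set
IsRank F X k =
  (Σ (Subset _) λ I → I ⊆ X × Independent F I × ∣ I ∣ ≡ k)
  × ((I : Subset _) → I ⊆ X → Independent F I → ∣ I ∣ ≤ k)

_∈cl[_]_ : ∀ {n} → Fin n → Flag n → Subset n → Set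
x ∈cl[ F ] X = ∃ λ k → IsRank F X k × IsRank F (X ∪ ⁅ x ⁆) k

IsMaxTight : ∀ {n} → (F : Flag n) → Subset n → Fin (suc (r F)) → Set
IsMaxTight F A m =
  (∣ A ∩ set F m ∣ ≡ toℕ m)
  × ((j : Fin (suc (r F))) → ∣ A ∩ set F j ∣ ≡ toℕ j → toℕ j ≤ toℕ m)

-- An independent set A has rank ∣ A ∣, so x ∈ cl(A) iff A ∪ {x} has no independent subset
-- larger than A.  If x ∈ A ∪ S_m, every independent I ⊆ A ∪ S_m meets S_m in at most
-- m = ∣ A ∩ S_m ∣ points and lies in A outside S_m, so ∣ I ∣ ≤ ∣ A ∣.  If x ∉ A ∪ S_m, then
-- A ∪ {x} is itself independent: a level S_i containing x is not contained in S_m, hence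
-- i > m is not tight for A, leaving room for x.
module Submission where

open import Defs
open import Data.Nat using (ℕ; suc; _+_; _≤_; _<_; z≤n; s≤s)
open import Data.Nat.Properties
open import Data.Fin using (Fin; toℕ) renaming (_≤_ to _≤ᶠ_)
open import Data.Fin.Induction using (<-weakInduction-startingFrom)
open import Data.Fin.Subset
open import Data.Fin.Subset.Properties
open import Data.Vec using ([]; _∷_; here; there)
open import Data.Bool using (true; false)
open import Data.Product using (_×_; _,_; proj₁)
open import Data.Sum using (inj₁; inj₂)
open import Function using (_∘_; id)
open import Relation.Nullary using (yes; no; ¬_; contradiction)
open import Relation.Binary.PropositionalEquality

∣p∣≡∣p∩q∣+∣p─q∣ : ∀ {n} (p q : Subset n) → ∣ p ∣ ≡ ∣ p ∩ q ∣ + ∣ p ─ q ∣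
∣p∣≡∣p∩q∣+∣p─q∣ []          []          = refl
∣p∣≡∣p∩q∣+∣p─q∣ (false ∷ p) (true  ∷ q) = ∣p∣≡∣p∩q∣+∣p─q∣ p q
∣p∣≡∣p∩q∣+∣p─q∣ (false ∷ p) (false ∷ q) = ∣p∣≡∣p∩q∣+∣p─q∣ p q
∣p∣≡∣p∩q∣+∣p─q∣ (true  ∷ p) (true  ∷ q) = cong suc (∣p∣≡∣p∩q∣+∣p─q∣ p q)
∣p∣≡∣p∩q∣+∣p─q∣ (true  ∷ p) (false ∷ q) =
  trans (cong suc (∣p∣≡∣p∩q∣+∣p─q∣ p q)) (sym (+-suc ∣ p ∩ q ∣ ∣ p ─ q ∣))

∣p∪q∣≤∣p∣+∣q∣ : ∀ {n} (p q : Subset n) → ∣ p ∪ q ∣ ≤ ∣ p ∣ + ∣ q ∣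
∣p∪q∣≤∣p∣+∣q∣ []          []          = z≤n
∣p∪q∣≤∣p∣+∣q∣ (false ∷ p) (false ∷ q) = ∣p∪q∣≤∣p∣+∣q∣ p q
∣p∪q∣≤∣p∣+∣q∣ (true  ∷ p) (false ∷ q) = s≤s (∣p∪q∣≤∣p∣+∣q∣ p q)
∣p∪q∣≤∣p∣+∣q∣ (false ∷ p) (true  ∷ q) rewrite +-suc ∣ p ∣ ∣ q ∣ = s≤s (∣p∪q∣≤∣p∣+∣q∣ p q)
∣p∪q∣≤∣p∣+∣q∣ (true  ∷ p) (true  ∷ q) rewrite +-suc ∣ p ∣ ∣ q ∣ =
  s≤s (m≤n⇒m≤1+n (∣p∪q∣≤∣p∣+∣q∣ p q))

x∈p─q⇒x∉q : ∀ {n} {x : Fin n} {p q : Subset n} → x ∈ p ─ q → x ∉ q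
x∈p─q⇒x∉q {p = _ ∷ _} {q = false ∷ _} here        ()
x∈p─q⇒x∉q {p = _ ∷ _} {q = _     ∷ _} (there x∈) (there x∈q) = x∈p─q⇒x∉q x∈ x∈q

p⊆q∪r⇒p─r⊆q─r : ∀ {n} {p q r : Subset n} → p ⊆ q ∪ r → p ─ r ⊆ q ─ r
p⊆q∪r⇒p─r⊆q─r {p = p} {q} {r} p⊆q∪r {x} x∈p─r with x∈p∪q⁻ q r (p⊆q∪r (p─q⊆p p r x∈p─r))
... | inj₁ x∈q = x∈p∧x∉q⇒x∈p─q x∈q (x∈p─q⇒x∉q x∈p─r)
... | inj₂ x∈r = contradiction x∈r (x∈p─q⇒x∉q x∈p─r)

p⊆q∪r⇒∣p∣≤∣q∣ : ∀ {n} {p q r : Subset n} → p ⊆ q ∪ r → ∣ p ∩ r ∣ ≤ ∣ q ∩ r ∣ → ∣ p ∣ ≤ ∣ q ∣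
p⊆q∪r⇒∣p∣≤∣q∣ {p = p} {q} {r} p⊆q∪r ∣p∩r∣≤∣q∩r∣ = begin
  ∣ p ∣                  ≡⟨ ∣p∣≡∣p∩q∣+∣p─q∣ p r ⟩
  ∣ p ∩ r ∣ + ∣ p ─ r ∣  ≤⟨ +-mono-≤ ∣p∩r∣≤∣q∩r∣ (p⊆q⇒∣p∣≤∣q∣ (p⊆q∪r⇒p─r⊆q─r p⊆q∪r)) ⟩
  ∣ q ∩ r ∣ + ∣ q ─ r ∣  ≡⟨ sym (∣p∣≡∣p∩q∣+∣p─q∣ q r) ⟩
  ∣ q ∣                  ∎
  where open ≤-Reasoning

[p∪q]∩r⊆p∩r∪q : ∀ {n} (p q r : Subset n) → (p ∪ q) ∩ r ⊆ (p ∩ r) ∪ q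
[p∪q]∩r⊆p∩r∪q p q r x∈ with x∈p∩q⁻ (p ∪ q) r x∈
... | x∈p∪q , x∈r with x∈p∪q⁻ p q x∈p∪q
...   | inj₁ x∈p = x∈p∪q⁺ (inj₁ (x∈p∩q⁺ (x∈p , x∈r)))
...   | inj₂ x∈q = x∈p∪q⁺ (inj₂ x∈q)

x∉r⇒[p∪⁅x⁆]∩r⊆p∩r : ∀ {n} {x : Fin n} (p r : Subset n) → x ∉ r → (p ∪ ⁅ x ⁆) ∩ r ⊆ p ∩ r
x∉r⇒[p∪⁅x⁆]∩r⊆p∩r {x = x} p r x∉r y∈ with x∈p∩q⁻ (p ∪ ⁅ x ⁆) r y∈
... | y∈p∪⁅x⁆ , y∈r with x∈p∪q⁻ p ⁅ x ⁆ y∈p∪⁅x⁆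
...   | inj₁ y∈p   = x∈p∩q⁺ (y∈p , y∈r)
...   | inj₂ y∈⁅x⁆ = contradiction (subst (_∈ r) (x∈⁅y⁆⇒x≡y x y∈⁅x⁆) y∈r) x∉r

p⊆r∧x∈r⇒p∪⁅x⁆⊆r : ∀ {n} {x : Fin n} {p r : Subset n} → p ⊆ r → x ∈ r → p ∪ ⁅ x ⁆ ⊆ r
p⊆r∧x∈r⇒p∪⁅x⁆⊆r {x = x} {p} p⊆r x∈r y∈ with x∈p∪q⁻ p ⁅ x ⁆ y∈
... | inj₁ y∈p   = p⊆r y∈p
... | inj₂ y∈⁅x⁆ = subst (_∈ _) (sym (x∈⁅y⁆⇒x≡y x y∈⁅x⁆)) x∈r

module _ {n : ℕ} (F : Flag n) where

  set-mono : {i j : Fin (suc (r F))} → i ≤ᶠ j → set F i ⊆ set F j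
  set-mono {i} = <-weakInduction-startingFrom (λ j → set F i ⊆ set F j) id
    (λ j Sᵢ⊆Sⱼ → proj₁ (strict F j) ∘ Sᵢ⊆Sⱼ)

  IsRank-of-maximal : {X A : Subset n} → A ⊆ X → Independent F A →
    ((I : Subset n) → I ⊆ X → Independent F I → ∣ I ∣ ≤ ∣ A ∣) → IsRank F X ∣ A ∣
  IsRank-of-maximal A⊆X indA maximal = (_ , A⊆X , indA , refl) , maximal

  independent⇒IsRank : {A : Subset n} → Independent F A → IsRank F A ∣ A ∣
  independent⇒IsRank indA = IsRank-of-maximal id indA (λ _ I⊆A _ → p⊆q⇒∣p∣≤∣q∣ I⊆A)

  independent-∪⁅x⁆⇒∉cl : {A : Subset n} {x : Fin n} → x ∉ A →
    Independent F (A ∪ ⁅ x ⁆) → ¬ (x ∈cl[ F ] A)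
  independent-∪⁅x⁆⇒∉cl {A} {x} x∉A indA∪x (k , ((I , I⊆A , _ , ∣I∣≡k) , _) , (_ , maximal)) =
    <⇒≱ ∣A∪x∣>k (maximal (A ∪ ⁅ x ⁆) id indA∪x)
    where
    ∣A∪x∣>k : k < ∣ A ∪ ⁅ x ⁆ ∣
    ∣A∪x∣>k = ≤-<-trans (subst (_≤ ∣ A ∣) ∣I∣≡k (p⊆q⇒∣p∣≤∣q∣ I⊆A))
      (p⊂q⇒∣p∣<∣q∣ (p⊆p∪q ⁅ x ⁆ , x , x∈p∪q⁺ (inj₂ (x∈⁅x⁆ x)) , x∉A))

  tight⇒∣I∣≤∣A∣ : (A : Subset n) {m : Fin (suc (r F))} → ∣ A ∩ set F m ∣ ≡ toℕ m →
    {I : Subset n} → Independent F I → I ⊆ A ∪ set F m → ∣ I ∣ ≤ ∣ A ∣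
  tight⇒∣I∣≤∣A∣ A {m} tight {I} indI I⊆A∪Sₘ =
    p⊆q∪r⇒∣p∣≤∣q∣ I⊆A∪Sₘ (subst (∣ I ∩ set F m ∣ ≤_) (sym tight) (indI m))

  independent-∪⁅x⁆ : (A : Subset n) → Independent F A → {m : Fin (suc (r F))} →
    ((j : Fin (suc (r F))) → ∣ A ∩ set F j ∣ ≡ toℕ j → j ≤ᶠ m) →
    {x : Fin n} → x ∉ set F m → Independent F (A ∪ ⁅ x ⁆)
  independent-∪⁅x⁆ A indA maximal {x} x∉Sₘ i with x ∈? set F i
  ... | no x∉Sᵢ = ≤-trans (p⊆q⇒∣p∣≤∣q∣ (x∉r⇒[p∪⁅x⁆]∩r⊆p∩r A (set F i) x∉Sᵢ)) (indA i)
  ... | yes x∈Sᵢ = begin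
    ∣ (A ∪ ⁅ x ⁆) ∩ set F i ∣      ≤⟨ p⊆q⇒∣p∣≤∣q∣ ([p∪q]∩r⊆p∩r∪q A ⁅ x ⁆ (set F i)) ⟩
    ∣ A ∩ set F i ∪ ⁅ x ⁆ ∣        ≤⟨ ∣p∪q∣≤∣p∣+∣q∣ (A ∩ set F i) ⁅ x ⁆ ⟩
    ∣ A ∩ set F i ∣ + ∣ ⁅ x ⁆ ∣    ≡⟨ cong (∣ A ∩ set F i ∣ +_) (∣⁅x⁆∣≡1 x) ⟩
    ∣ A ∩ set F i ∣ + 1            ≡⟨ +-comm ∣ A ∩ set F i ∣ 1 ⟩
    suc ∣ A ∩ set F i ∣            ≤⟨ ≤∧≢⇒< (indA i) (λ tight → x∉Sₘ (set-mono (maximal i tight) x∈Sᵢ)) ⟩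
    toℕ i                          ∎
    where open ≤-Reasoning

proposition5p4 : {n : ℕ} (F : Flag n) (A : Subset n) → Independent F A →
    (m : Fin (suc (r F))) → IsMaxTight F A m →
    (x : Fin n) → (x ∈cl[ F ] A → x ∈ A ∪ set F m) × (x ∈ A ∪ set F m → x ∈cl[ F ] A)
proposition5p4 F A indA m (tight , maximal) x = cl⇒∈A∪Sₘ , ∈A∪Sₘ⇒cl
  where
  cl⇒∈A∪Sₘ : x ∈cl[ F ] A → x ∈ A ∪ set F m
  cl⇒∈A∪Sₘ x∈clA with x ∈? A ∪ set F m
  ... | yes x∈A∪Sₘ = x∈A∪Sₘ
  ... | no  x∉A∪Sₘ = contradiction x∈clA
    (independent-∪⁅x⁆⇒∉cl F (x∉A∪Sₘ ∘ x∈p∪q⁺ ∘ inj₁)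
      (independent-∪⁅x⁆ F A indA maximal (x∉A∪Sₘ ∘ x∈p∪q⁺ ∘ inj₂)))

  ∈A∪Sₘ⇒cl : x ∈ A ∪ set F m → x ∈cl[ F ] A
  ∈A∪Sₘ⇒cl x∈A∪Sₘ = ∣ A ∣ , independent⇒IsRank F indA ,
    IsRank-of-maximal F (p⊆p∪q ⁅ x ⁆) indA λ _ I⊆A∪⁅x⁆ indI →
      tight⇒∣I∣≤∣A∣ F A tight indI (⊆-trans I⊆A∪⁅x⁆ (p⊆r∧x∈r⇒p∪⁅x⁆⊆r (p⊆p∪q (set F m)) x∈A∪Sₘ))
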